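{- Let $d \geq 1$ and let $P$ be a $d$-dimensional 0-1 matrix. Then for every positive integer $n$, $ex(n,F_{P,3},d+1) \leq 3\,(ex(n,P,d)\, n+ n^{d})$.
   Context: A $d$-dimensional 0-1 matrix with sidelengths $n_1,\dots,n_d$ is a function $[n_1]\times\cdots\times[n_d]\to\{0,1\}$; entries with value 1 are ones. $M$ contains $P$ if there are, for each dimension $i$, strictly increasing maps from the $i$-th index set of $P$ into that of $M$ sending every one of $P$ to a one of $M$; otherwise $M$ avoids $P$; $M$ avoids a family if it avoids every member. $ex(n,P,d)$ is the maximum number of ones in a $P$-avoiding $d$-dimensional 0-1 matrix with all sidelengths $n$ (similarly for a family). A $1$-row of a $(d+1)$-dimensional matrix is a set of entries all of whose coordinates other than the first are equal. If $P$ has $r$ ones, a $(P,s)$-formation is a set of $sr$ ones in a $(d+1)$-dimensional 0-1 matrix that can be partitioned into $s$ disjoint groups $G_1,\dots,G_s$ of $r$ ones each such that: any two groups have ones in exactly the same set of $1$-rows; for $i<j$ the maximum first coordinate of a one in $G_i$ is less than the minimum first coordinate of a one in $G_j$; and the set $S$ of points obtained by deleting the first coordinate of each of these ones (counting repeated points once) forms the pattern $P$, i.e. there are strictly increasing maps $\varphi_i$ from the $i$-th index set of $P$ to the integers with $S=\{(\varphi_1(x_1),\dots,\varphi_d(x_d)) : x \text{ a one of } P\}$. $F_{P,s}$ is the family of all $(P,s)$-formations, and $ex(n,F_{P,s},d+1)$ is the maximum number of ones in a $(d+1)$-dimensional 0-1 matrix of sidelength $n$ in every dimension containing no $(P,s)$-formation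 among its ones. -}

module Defs where

open import Data.Nat using (ℕ; zero; suc; _<_; _≤_)
open import Data.Integer using (ℤ; +_)
open import Data.Bool using (Bool; T)
open import Data.Fin using (Fin)
import Data.Fin as Fin
open import Data.List using (List; []; _∷_; [_]; length; filterᵇ; concatMap; upTo; allFin)
import Data.List as List
open import Data.Vec using (Vec; []; _∷_; lookup; tabulate; replicate; head; tail)
open import Data.List.Membership.Propositional using (_∈_)
open import Data.List.Relation.Unary.Unique.Propositional using (Unique)
open import Data.Product using (Σ; ∃; _×_)
open import Relation.Nullary using (¬_)
open import Relation.Binary.PropositionalEquality using (_≡_)

-- Points of a d-dimensional matrix: vectors of (0-based) coordinates.
Point : ℕ → Set
Point d = Vec ℕ d

-- A d-dimensional 0-1 matrix; it is always used together with a vector of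
-- sidelengths ns, and only its values on the box [ns] are relevant.
Matrix : ℕ → Set
Matrix d = Point d → Bool

InBox : ∀ {d} → Vec ℕ d → Point d → Set
InBox {d} ns x = ∀ (i : Fin d) → lookup x i < lookup ns i

box : ∀ {d} → Vec ℕ d → List (Point d)
box [] = [ [] ]
box (n ∷ ns) = concatMap (λ a → List.map (a ∷_) (box ns)) (upTo n)

onesCount : ∀ {d} → Vec ℕ d → Matrix d → ℕ
onesCount ns M = length (filterᵇ M (box ns))

IsOne : ∀ {d} → Vec ℕ d → Matrix d → Point d → Set
IsOne ns M x = InBox ns x × T (M x)

applyMaps : ∀ {d} {A : Set} → (Fin d → ℕ → A) → Point d → Vec A d
applyMaps φ x = tabulate (λ i → φ i (lookup x i))

Contains : ∀ {d} → Vec ℕ d → Matrix d → Vec ℕ d → Matrix d → Set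
Contains {d} ms M ps P =
  Σ (Fin d → ℕ → ℕ) λ φ →
    (∀ i a b → a < b → b < lookup ps i → φ i a < φ i b) ×
    (∀ i a → a < lookup ps i → φ i a < lookup ms i) ×
    (∀ x → IsOne ps P x → T (M (applyMaps φ x)))

Avoids : ∀ {d} → Vec ℕ d → Matrix d → Vec ℕ d → Matrix d → Set
Avoids ms M ps P = ¬ Contains ms M ps P

IsMaxOnes : (d n : ℕ) → (Matrix d → Set) → ℕ → Set
IsMaxOnes d n Good e =
  (Σ (Matrix d) λ M → Good M × onesCount (replicate d n) M ≡ e) ×
  (∀ M → Good M → onesCount (replicate d n) M ≤ e)

IsEx : (d n : ℕ) → Vec ℕ d → Matrix d → ℕ → Set
IsEx d n ps P e = IsMaxOnes d n (λ M → Avoids (replicate d n) M ps P) e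

FormsPattern : ∀ {d} → (Point d → Set) → Vec ℕ d → Matrix d → Set
FormsPattern {d} S ps P =
  Σ (Fin d → ℕ → ℤ) λ φ →
    (∀ i a b → a < b → b < lookup ps i → φ i a Data.Integer.< φ i b) ×
    (∀ x → IsOne ps P x → ∃ λ y → S y × applyMaps φ x ≡ Data.Vec.map +_ y) ×
    (∀ y → S y → ∃ λ x → IsOne ps P x × applyMaps φ x ≡ Data.Vec.map +_ y)

-- The first coordinate is the head of the point vector; the
-- 1-row of a point z is determined by tail z.
Formation : ∀ {d} → ℕ → Matrix (suc d) → Vec ℕ d → Matrix d → ℕ → Set
Formation {d} n M ps P s =
  Σ (Fin s → List (Point (suc d))) λ G →
    (∀ i → length (G i) ≡ onesCount ps P) ×
    Unique (concatMap G (allFin s)) ×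
    (∀ i z → z ∈ G i → IsOne (replicate (suc d) n) M z) ×
    (∀ i j z → z ∈ G i → ∃ λ w → w ∈ G j × tail z ≡ tail w) ×
    (∀ i j → i Fin.< j → ∀ z w → z ∈ G i → w ∈ G j → head z < head w) ×
    FormsPattern (λ y → ∃ λ i → ∃ λ z → z ∈ G i × tail z ≡ y) ps P

IsExFormation : (d n : ℕ) → Vec ℕ d → Matrix d → ℕ → ℕ → Set
IsExFormation d n ps P s e =
  IsMaxOnes (suc d) n (λ M → ¬ Formation n M ps P s) e

-- Cut the (d+1)-dimensional matrix M into the n slices a = 0, …, n-1 along the
-- first coordinate. A one of slice a is interior if its 1-row also has a one
-- before a and a one after a; every other one is the first or the last one of
-- its 1-row, so there are at most 2 n^d of them. The interior ones of a single
-- slice avoid P: a copy of P among them, together with one earlier and one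
-- later one in each of its 1-rows, is a (P,3)-formation. Hence M has at most
-- n ex(n,P,d) + 2 n^d ones.
module Submission where

open import Defs
open import Data.Bool using (Bool; true; false; T; not; _∧_; if_then_else_)
open import Data.Bool.Properties using (T-∧)
open import Data.Bool.ListAction using (any)
open import Data.Empty using (⊥-elim)
open import Data.Fin using (Fin; zero; suc)
import Data.Fin as Fin
import Data.Integer as ℤ
open import Data.List
  using (List; []; _∷_; _++_; length; map; concat; concatMap; filterᵇ; upTo; allFin; cartesianProductWith)
open import Data.List.Properties using (length-map; length-++; length-upTo; map-tabulate)
open import Data.List.Membership.Propositional using (_∈_; lose)
open import Data.List.Membership.Propositional.Properties
  using (∈-map⁺; ∈-map⁻; ∈-filter⁺; ∈-filter⁻; ∈-upTo⁺; ∈-upTo⁻; ∈-cartesianProductWith⁺; ∈-cartesianProductWith⁻)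
open import Data.List.Relation.Binary.Disjoint.Propositional using (Disjoint)
open import Data.List.Relation.Unary.All using ([]; _∷_)
import Data.List.Relation.Unary.All as All
import Data.List.Relation.Unary.All.Properties as All
open import Data.List.Relation.Unary.AllPairs using ([]; _∷_)
open import Data.List.Relation.Unary.AllPairs.Properties using (tabulate⁺-<)
open import Data.List.Relation.Unary.Any using (here; there)
open import Data.List.Relation.Unary.Any.Properties using (any⁺)
open import Data.List.Relation.Unary.Unique.Propositional using (Unique)
open import Data.List.Relation.Unary.Unique.Propositional.Properties
  using (concat⁺; filter⁺; upTo⁺; cartesianProductWith⁺)
import Data.Nat as ℕ
open import Data.Nat using (ℕ; _≤_; _<_; _+_; _*_; _^_; _<ᵇ_; z≤n; s≤s)
open import Data.Nat.Properties
open import Data.Nat.Tactic.RingSolver using (solve-∀)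
open import Data.Product using (∃; _×_; _,_; proj₁; proj₂)
import Data.Product as Product
open import Data.Sum using (_⊎_; inj₁; inj₂)
import Data.Sum as Sum
open import Data.Vec using (Vec; _∷_; lookup; replicate; head; tail)
import Data.Vec as Vec
open import Data.Vec.Properties using (lookup∘tabulate; tabulate∘lookup; tabulate-cong; tabulate-∘; ∷-injective; ∷-injectiveʳ)
open import Function using (_∘_; id; Equivalence)
open import Relation.Binary.Definitions using (tri<; tri≈; tri>)
open import Relation.Binary.PropositionalEquality using (_≡_; refl; sym; trans; cong; cong₂; subst; module ≡-Reasoning)
open import Relation.Nullary using (¬_)
open import Relation.Nullary.Decidable.Core using (T?)
open import Algebra.Properties.CommutativeSemigroup +-commutativeSemigroup using (interchange)

private variable
  A B C : Set

indicator : Bool → ℕ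
indicator true  = 1
indicator false = 0

sumBy : (A → ℕ) → List A → ℕ
sumBy w []       = 0
sumBy w (x ∷ xs) = w x + sumBy w xs

length-filterᵇ : (p : A → Bool) (xs : List A) → length (filterᵇ p xs) ≡ sumBy (indicator ∘ p) xs
length-filterᵇ p []       = refl
length-filterᵇ p (x ∷ xs) with p x
... | true  = cong ℕ.suc (length-filterᵇ p xs)
... | false = length-filterᵇ p xs

sumBy-zero : (xs : List A) → sumBy (λ _ → 0) xs ≡ 0
sumBy-zero []       = refl
sumBy-zero (x ∷ xs) = sumBy-zero xs

sumBy-cong : {u v : A → ℕ} → (∀ x → u x ≡ v x) → (xs : List A) → sumBy u xs ≡ sumBy v xs
sumBy-cong u≡v []       = refl
sumBy-cong u≡v (x ∷ xs) = cong₂ _+_ (u≡v x) (sumBy-cong u≡v xs)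

sumBy-mono : {u v : A → ℕ} → (∀ x → u x ≤ v x) → (xs : List A) → sumBy u xs ≤ sumBy v xs
sumBy-mono u≤v []       = z≤n
sumBy-mono u≤v (x ∷ xs) = +-mono-≤ (u≤v x) (sumBy-mono u≤v xs)

sumBy-+ : (u v : A → ℕ) (xs : List A) → sumBy (λ x → u x + v x) xs ≡ sumBy u xs + sumBy v xs
sumBy-+ u v []       = refl
sumBy-+ u v (x ∷ xs) = trans (cong (u x + v x +_) (sumBy-+ u v xs)) (interchange (u x) (v x) _ _)

sumBy-++ : (w : A → ℕ) (xs ys : List A) → sumBy w (xs ++ ys) ≡ sumBy w xs + sumBy w ys
sumBy-++ w []       ys = refl
sumBy-++ w (x ∷ xs) ys = trans (cong (w x +_) (sumBy-++ w xs ys)) (sym (+-assoc (w x) _ _))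

sumBy-map : (w : B → ℕ) (f : A → B) (xs : List A) → sumBy w (map f xs) ≡ sumBy (w ∘ f) xs
sumBy-map w f []       = refl
sumBy-map w f (x ∷ xs) = cong (w (f x) +_) (sumBy-map w f xs)

sumBy-concatMap : (w : B → ℕ) (f : A → List B) (xs : List A) →
                  sumBy w (concatMap f xs) ≡ sumBy (sumBy w ∘ f) xs
sumBy-concatMap w f []       = refl
sumBy-concatMap w f (x ∷ xs) =
  trans (sumBy-++ w (f x) _) (cong (sumBy w (f x) +_) (sumBy-concatMap w f xs))

sumBy-comm : (w : A → B → ℕ) (xs : List A) (ys : List B) →
             sumBy (λ x → sumBy (w x) ys) xs ≡ sumBy (λ y → sumBy (λ x → w x y) xs) ys
sumBy-comm w []       ys = sym (sumBy-zero ys)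
sumBy-comm w (x ∷ xs) ys =
  trans (cong (sumBy (w x) ys +_) (sumBy-comm w xs ys)) (sym (sumBy-+ (w x) _ ys))

sumBy-≤-* : (w : A → ℕ) (c : ℕ) (xs : List A) → (∀ {x} → x ∈ xs → w x ≤ c) → sumBy w xs ≤ length xs * c
sumBy-≤-* w c []       w≤c = z≤n
sumBy-≤-* w c (x ∷ xs) w≤c = +-mono-≤ (w≤c (here refl)) (sumBy-≤-* w c xs (w≤c ∘ there))

all-equal⇒length≤1 : {xs : List A} → Unique xs → (∀ {x y} → x ∈ xs → y ∈ xs → x ≡ y) → length xs ≤ 1
all-equal⇒length≤1 {xs = []}          _                  _     = z≤n
all-equal⇒length≤1 {xs = _ ∷ []}      _                  _     = s≤s z≤n
all-equal⇒length≤1 {xs = _ ∷ _ ∷ _} ((x≢y ∷ _) ∷ _) equal = ⊥-elim (x≢y (equal (here refl) (there (here refl))))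

count-minimal≤1 : (_≺_ : A → A → Bool) → (∀ x y → x ≡ y ⊎ T (x ≺ y) ⊎ T (y ≺ x)) →
                  (f : A → Bool) {xs : List A} → Unique xs →
                  length (filterᵇ (λ a → f a ∧ not (any (λ c → c ≺ a ∧ f c) xs)) xs) ≤ 1
count-minimal≤1 {A} _≺_ trichotomy f {xs} unique = all-equal⇒length≤1 (filter⁺ (T? ∘ minimal) unique) minimal-unique
  where
  minimal : A → Bool
  minimal a = f a ∧ not (any (λ c → c ≺ a ∧ f c) xs)

  T-not : ∀ {b} → T (not b) → ¬ T b
  T-not {true}  ()
  T-not {false} _ ()

  ≺-not-minimal : ∀ {a b} → a ∈ xs → T (f a) → T (a ≺ b) → ¬ T (minimal b)
  ≺-not-minimal a∈xs fa a≺b mb =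
    T-not (proj₂ (Equivalence.to T-∧ mb)) (any⁺ _ (lose a∈xs (Equivalence.from T-∧ (a≺b , fa))))

  minimal-unique : ∀ {a b} → a ∈ filterᵇ minimal xs → b ∈ filterᵇ minimal xs → a ≡ b
  minimal-unique {a} {b} a∈ b∈ with ∈-filter⁻ (T? ∘ minimal) a∈ | ∈-filter⁻ (T? ∘ minimal) b∈ | trichotomy a b
  ... | _ , _ | _ , _ | inj₁ a≡b = a≡b
  ... | a∈xs , ma | _ , mb | inj₂ (inj₁ a≺b) = ⊥-elim (≺-not-minimal a∈xs (proj₁ (Equivalence.to T-∧ ma)) a≺b mb)
  ... | _ , ma | b∈xs , mb | inj₂ (inj₂ b≺a) = ⊥-elim (≺-not-minimal b∈xs (proj₁ (Equivalence.to T-∧ mb)) b≺a ma)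

-- The default x₀ is returned when no element satisfies p.
choose : (A → Bool) → A → List A → A
choose p x₀ []       = x₀
choose p x₀ (x ∷ xs) = if p x then x else choose p x₀ xs

choose-witness : (p : A → Bool) (x₀ : A) (xs : List A) → T (any p xs) →
                 choose p x₀ xs ∈ xs × T (p (choose p x₀ xs))
choose-witness p x₀ (x ∷ xs) t with p x in px
... | true  = here refl , subst T (sym px) _
... | false = Product.map there id (choose-witness p x₀ xs t)

map⁺-on : {f : A → B} {xs : List A} → (∀ {x y} → x ∈ xs → y ∈ xs → f x ≡ f y → x ≡ y) →
          Unique xs → Unique (map f xs)
map⁺-on inj []             = []
map⁺-on inj (x∉xs ∷ unique) =
  All.map⁺ (All.tabulate λ y∈xs fx≡fy → All.lookup x∉xs y∈xs (inj (here refl) (there y∈xs) fx≡fy))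
  ∷ map⁺-on (λ x∈xs y∈xs → inj (there x∈xs) (there y∈xs)) unique

concatMap-map≡cartesianProductWith : (f : A → B → C) (xs : List A) (ys : List B) →
                                     concatMap (λ x → map (f x) ys) xs ≡ cartesianProductWith f xs ys
concatMap-map≡cartesianProductWith f []       ys = refl
concatMap-map≡cartesianProductWith f (x ∷ xs) ys = cong (map (f x) ys ++_) (concatMap-map≡cartesianProductWith f xs ys)

length-cartesianProductWith : (f : A → B → C) (xs : List A) (ys : List B) →
                              length (cartesianProductWith f xs ys) ≡ length xs * length ys
length-cartesianProductWith f []       ys = refl
length-cartesianProductWith f (x ∷ xs) ys =
  trans (length-++ (map (f x) ys)) (cong₂ _+_ (length-map (f x) ys) (length-cartesianProductWith f xs ys))

box-∷ : ∀ {d} n (ns : Vec ℕ d) → box (n ∷ ns) ≡ cartesianProductWith _∷_ (upTo n) (box ns)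
box-∷ n ns = concatMap-map≡cartesianProductWith _∷_ (upTo n) (box ns)

∈-box⁺ : ∀ {d} (ns : Vec ℕ d) {x} → InBox ns x → x ∈ box ns
∈-box⁺ Vec.[]   {Vec.[]} _    = here refl
∈-box⁺ (n ∷ ns) {a ∷ x}  x∈ns = subst (a ∷ x ∈_) (sym (box-∷ n ns))
  (∈-cartesianProductWith⁺ _∷_ (∈-upTo⁺ (x∈ns zero)) (∈-box⁺ ns (x∈ns ∘ suc)))

∈-box⁻ : ∀ {d} (ns : Vec ℕ d) {x} → x ∈ box ns → InBox ns x
∈-box⁻ Vec.[]   _ ()
∈-box⁻ (n ∷ ns) x∈ with ∈-cartesianProductWith⁻ _∷_ (upTo n) (box ns) (subst (_ ∈_) (box-∷ n ns) x∈)
... | a , y , a∈ , y∈ , refl = λ { zero → ∈-upTo⁻ a∈ ; (suc i) → ∈-box⁻ ns y∈ i }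

box-unique : ∀ {d} (ns : Vec ℕ d) → Unique (box ns)
box-unique Vec.[]   = [] ∷ []
box-unique (n ∷ ns) = subst Unique (sym (box-∷ n ns))
  (cartesianProductWith⁺ _∷_ ∷-injective (upTo⁺ n) (box-unique ns))

length-box : ∀ d n → length (box (replicate d n)) ≡ n ^ d
length-box ℕ.zero    n = refl
length-box (ℕ.suc d) n = begin
  length (box (n ∷ replicate d n))                                  ≡⟨ cong length (box-∷ n (replicate d n)) ⟩
  length (cartesianProductWith _∷_ (upTo n) (box (replicate d n)))  ≡⟨ length-cartesianProductWith _∷_ (upTo n) (box (replicate d n)) ⟩
  length (upTo n) * length (box (replicate d n))                    ≡⟨ cong₂ _*_ (length-upTo n) (length-box d n) ⟩
  n * n ^ d                                                         ∎
  where open ≡-Reasoning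

onesCount-slices : ∀ {d} n (ns : Vec ℕ d) (M : Matrix (ℕ.suc d)) →
                   onesCount (n ∷ ns) M ≡ sumBy (λ a → onesCount ns (λ r → M (a ∷ r))) (upTo n)
onesCount-slices n ns M = begin
  length (filterᵇ M (box (n ∷ ns)))                                       ≡⟨ length-filterᵇ M (box (n ∷ ns)) ⟩
  sumBy (indicator ∘ M) (concatMap (λ a → map (a ∷_) (box ns)) (upTo n))  ≡⟨ sumBy-concatMap _ _ (upTo n) ⟩
  sumBy (λ a → sumBy (indicator ∘ M) (map (a ∷_) (box ns))) (upTo n)      ≡⟨ sumBy-cong slice (upTo n) ⟩
  sumBy (λ a → onesCount ns (λ r → M (a ∷ r))) (upTo n)                   ∎
  where
  open ≡-Reasoning
  slice : ∀ a → sumBy (indicator ∘ M) (map (a ∷_) (box ns)) ≡ onesCount ns (λ r → M (a ∷ r))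
  slice a = trans (sumBy-map _ (a ∷_) (box ns)) (sym (length-filterᵇ _ (box ns)))

module _ {d : ℕ} {φ : Fin d → ℕ → ℕ} where

  lookup-applyMaps : ∀ x i → lookup (applyMaps φ x) i ≡ φ i (lookup x i)
  lookup-applyMaps x i = lookup∘tabulate (λ j → φ j (lookup x j)) i

  applyMaps-inBox : ∀ {ps ms : Vec ℕ d} → (∀ i a → a < lookup ps i → φ i a < lookup ms i) →
                    ∀ {x} → InBox ps x → InBox ms (applyMaps φ x)
  applyMaps-inBox {ms = ms} φ-bounded {x} x∈ps i =
    subst (_< lookup ms i) (sym (lookup-applyMaps x i)) (φ-bounded i (lookup x i) (x∈ps i))

  applyMaps-injective : ∀ {ps : Vec ℕ d} → (∀ i a b → a < b → b < lookup ps i → φ i a < φ i b) →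
                        ∀ {x y} → InBox ps x → InBox ps y → applyMaps φ x ≡ applyMaps φ y → x ≡ y
  applyMaps-injective {ps} φ-increasing {x} {y} x∈ps y∈ps φx≡φy =
    trans (sym (tabulate∘lookup x)) (trans (tabulate-cong lookup-equal) (tabulate∘lookup y))
    where
    φ-injective : ∀ i {a b} → a < lookup ps i → b < lookup ps i → φ i a ≡ φ i b → a ≡ b
    φ-injective i {a} {b} a<p b<p φa≡φb with <-cmp a b
    ... | tri< a<b _ _ = ⊥-elim (<-irrefl φa≡φb (φ-increasing i a b a<b b<p))
    ... | tri≈ _ a≡b _ = a≡b
    ... | tri> _ _ b<a = ⊥-elim (<-irrefl (sym φa≡φb) (φ-increasing i b a b<a a<p))

    lookup-equal : ∀ i → lookup x i ≡ lookup y i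
    lookup-equal i = φ-injective i (x∈ps i) (y∈ps i)
      (trans (sym (lookup-applyMaps x i)) (trans (cong (λ z → lookup z i) φx≡φy) (lookup-applyMaps y i)))

-- Layers must be ordered across different rows r, r′: every one of group i
-- has to precede every one of group j.
module StackedCopy {d n s : ℕ} {M : Matrix (ℕ.suc d)} {ps : Vec ℕ d} {P Q : Matrix d}
  (h : Fin (ℕ.suc s) → Point d → ℕ)
  (layer-one : ∀ {r} → T (Q r) → ∀ i → h i r < n × T (M (h i r ∷ r)))
  (layers-ordered : ∀ {r r′} → T (Q r) → T (Q r′) → ∀ {i j} → i Fin.< j → h i r < h j r′)
  (φ : Fin d → ℕ → ℕ)
  (φ-increasing : ∀ i a b → a < b → b < lookup ps i → φ i a < φ i b)
  (φ-bounded : ∀ i a → a < lookup ps i → φ i a < lookup (replicate d n) i)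
  (φ-ones : ∀ x → IsOne ps P x → T (Q (applyMaps φ x)))
  where

  onesP : List (Point d)
  onesP = filterᵇ P (box ps)

  ∈-onesP⁺ : ∀ {x} → IsOne ps P x → x ∈ onesP
  ∈-onesP⁺ (x∈ps , Px) = ∈-filter⁺ (T? ∘ P) (∈-box⁺ ps x∈ps) Px

  ∈-onesP⁻ : ∀ {x} → x ∈ onesP → IsOne ps P x
  ∈-onesP⁻ x∈ = Product.map₁ (∈-box⁻ ps) (∈-filter⁻ (T? ∘ P) x∈)

  row : Point d → Point d
  row = applyMaps φ

  Q-row : ∀ {x} → x ∈ onesP → T (Q (row x))
  Q-row x∈ = φ-ones _ (∈-onesP⁻ x∈)

  lift : Fin (ℕ.suc s) → Point d → Point (ℕ.suc d)
  lift i x = h i (row x) ∷ row x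

  group : Fin (ℕ.suc s) → List (Point (ℕ.suc d))
  group i = map (lift i) onesP

  groups-ordered : ∀ i j → i Fin.< j → ∀ z w → z ∈ group i → w ∈ group j → head z < head w
  groups-ordered i j i<j z w z∈ w∈ with ∈-map⁻ (lift i) z∈ | ∈-map⁻ (lift j) w∈
  ... | x , x∈ , refl | y , y∈ , refl = layers-ordered (Q-row x∈) (Q-row y∈) i<j

  group-unique : ∀ i → Unique (group i)
  group-unique i = map⁺-on lift-injective (filter⁺ (T? ∘ P) (box-unique ps))
    where
    lift-injective : ∀ {x y} → x ∈ onesP → y ∈ onesP → lift i x ≡ lift i y → x ≡ y
    lift-injective {x} {y} x∈ y∈ eq =
      applyMaps-injective {ps = ps} φ-increasing {x} {y} (proj₁ (∈-onesP⁻ x∈)) (proj₁ (∈-onesP⁻ y∈)) (∷-injectiveʳ eq)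

  groups-unique : Unique (concatMap group (allFin (ℕ.suc s)))
  groups-unique = subst Unique (cong concat (sym (map-tabulate id group)))
    (concat⁺ (All.tabulate⁺ group-unique) (tabulate⁺-< disjoint))
    where
    disjoint : ∀ {i j} → i Fin.< j → Disjoint (group i) (group j)
    disjoint i<j (z∈ , z∈′) = <-irrefl refl (groups-ordered _ _ i<j _ _ z∈ z∈′)

  group-ones : ∀ i z → z ∈ group i → IsOne (replicate (ℕ.suc d) n) M z
  group-ones i z z∈ with ∈-map⁻ (lift i) z∈
  ... | x , x∈ , refl = in-box , proj₂ (layer-one (Q-row x∈) i)
    where
    in-box : InBox (replicate (ℕ.suc d) n) (lift i x)
    in-box zero    = proj₁ (layer-one (Q-row x∈) i)
    in-box (suc j) = applyMaps-inBox {ps = ps} {ms = replicate d n} φ-bounded {x} (proj₁ (∈-onesP⁻ x∈)) j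

  rows-shared : ∀ i j z → z ∈ group i → ∃ λ w → w ∈ group j × tail z ≡ tail w
  rows-shared i j z z∈ with ∈-map⁻ (lift i) z∈
  ... | x , x∈ , refl = lift j x , ∈-map⁺ (lift j) x∈ , refl

  φℤ-row : ∀ x → applyMaps (λ i a → ℤ.+ φ i a) x ≡ Vec.map ℤ.+_ (row x)
  φℤ-row x = tabulate-∘ ℤ.+_ (λ i → φ i (lookup x i))

  rows-form-P : FormsPattern (λ y → ∃ λ i → ∃ λ z → z ∈ group i × tail z ≡ y) ps P
  rows-form-P = (λ i a → ℤ.+ φ i a)
              , (λ i a b a<b b<p → ℤ.+<+ (φ-increasing i a b a<b b<p))
              , (λ x x-one → row x , (zero , lift zero x , ∈-map⁺ (lift zero) (∈-onesP⁺ x-one) , refl) , φℤ-row x)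
              , from-rows
    where
    from-rows : ∀ y → (∃ λ i → ∃ λ z → z ∈ group i × tail z ≡ y) →
                ∃ λ x → IsOne ps P x × applyMaps (λ i a → ℤ.+ φ i a) x ≡ Vec.map ℤ.+_ y
    from-rows y (i , z , z∈ , refl) with ∈-map⁻ (lift i) z∈
    ... | x , x∈ , refl = x , ∈-onesP⁻ x∈ , φℤ-row x

  formation : Formation n M ps P (ℕ.suc s)
  formation = group , (λ i → length-map (lift i) onesP) , groups-unique , group-ones , rows-shared
            , groups-ordered , rows-form-P

stacked-copy⇒formation :
  ∀ {d n s} {M : Matrix (ℕ.suc d)} {ps : Vec ℕ d} {P Q : Matrix d} (h : Fin (ℕ.suc s) → Point d → ℕ) →
  (∀ {r} → T (Q r) → ∀ i → h i r < n × T (M (h i r ∷ r))) →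
  (∀ {r r′} → T (Q r) → T (Q r′) → ∀ {i j} → i Fin.< j → h i r < h j r′) →
  Contains (replicate d n) Q ps P → Formation n M ps P (ℕ.suc s)
stacked-copy⇒formation {ps = ps} {Q = Q} h layer-one layers-ordered (φ , φ-increasing , φ-bounded , φ-ones) =
  StackedCopy.formation {ps = ps} {Q = Q} h layer-one layers-ordered φ φ-increasing φ-bounded φ-ones

<ᵇ-trichotomous : ∀ a b → a ≡ b ⊎ T (a <ᵇ b) ⊎ T (b <ᵇ a)
<ᵇ-trichotomous a b with <-cmp a b
... | tri< a<b _ _ = inj₂ (inj₁ (<⇒<ᵇ a<b))
... | tri≈ _ a≡b _ = inj₁ a≡b
... | tri> _ _ b<a = inj₂ (inj₂ (<⇒<ᵇ b<a))

module Slices {d : ℕ} (n : ℕ) (M : Matrix (ℕ.suc d)) where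

  hasOneBefore hasOneAfter : ℕ → Point d → Bool
  hasOneBefore a r = any (λ c → (c <ᵇ a) ∧ M (c ∷ r)) (upTo n)
  hasOneAfter  a r = any (λ c → (a <ᵇ c) ∧ M (c ∷ r)) (upTo n)

  interior firstInRow lastInRow : ℕ → Point d → Bool
  interior   a r = M (a ∷ r) ∧ (hasOneBefore a r ∧ hasOneAfter a r)
  firstInRow a r = M (a ∷ r) ∧ not (hasOneBefore a r)
  lastInRow  a r = M (a ∷ r) ∧ not (hasOneAfter a r)

  interior-parts : ∀ {a r} → T (interior a r) → T (M (a ∷ r)) × T (hasOneBefore a r) × T (hasOneAfter a r)
  interior-parts {a} {r} t = Product.map₂ (Equivalence.to (T-∧ {hasOneBefore a r})) (Equivalence.to (T-∧ {M (a ∷ r)}) t)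

  extremes : ℕ → Point d → ℕ
  extremes a r = indicator (firstInRow a r) + indicator (lastInRow a r)

  one≤interior+extremes : ∀ a r → indicator (M (a ∷ r)) ≤ indicator (interior a r) + extremes a r
  one≤interior+extremes a r with M (a ∷ r) | hasOneBefore a r | hasOneAfter a r
  ... | false | _     | _     = z≤n
  ... | true  | true  | true  = s≤s z≤n
  ... | true  | true  | false = s≤s z≤n
  ... | true  | false | _     = s≤s z≤n

  extremes-in-row≤2 : ∀ r → sumBy (λ a → extremes a r) (upTo n) ≤ 2
  extremes-in-row≤2 r = begin
    sumBy (λ a → extremes a r) (upTo n)
      ≡⟨ sumBy-+ _ _ (upTo n) ⟩
    sumBy (indicator ∘ first) (upTo n) + sumBy (indicator ∘ last) (upTo n)
      ≡⟨ sym (cong₂ _+_ (length-filterᵇ first (upTo n)) (length-filterᵇ last (upTo n))) ⟩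
    length (filterᵇ first (upTo n)) + length (filterᵇ last (upTo n))
      ≤⟨ +-mono-≤ (count-minimal≤1 _<ᵇ_ <ᵇ-trichotomous (λ c → M (c ∷ r)) (upTo⁺ n))
                  (count-minimal≤1 (λ c a → a <ᵇ c) (λ a b → Sum.map₂ Sum.swap (<ᵇ-trichotomous a b))
                                   (λ c → M (c ∷ r)) (upTo⁺ n)) ⟩
    2 ∎
    where
    open ≤-Reasoning
    first last : ℕ → Bool
    first a = firstInRow a r
    last  a = lastInRow a r

  onesCount≤interior+extremes : (ns : Vec ℕ d) →
    onesCount (n ∷ ns) M ≤ sumBy (λ a → onesCount ns (interior a)) (upTo n) + length (box ns) * 2
  onesCount≤interior+extremes ns = begin
    onesCount (n ∷ ns) M                                                  ≡⟨ onesCount-slices n ns M ⟩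
    sumBy (λ a → onesCount ns (λ r → M (a ∷ r))) (upTo n)                 ≤⟨ sumBy-mono slice≤ (upTo n) ⟩
    sumBy (λ a → onesCount ns (interior a) + sumBy (extremes a) (box ns)) (upTo n)
      ≡⟨ sumBy-+ _ _ (upTo n) ⟩
    sumBy (λ a → onesCount ns (interior a)) (upTo n) + sumBy (λ a → sumBy (extremes a) (box ns)) (upTo n)
      ≡⟨ cong (sumBy (λ a → onesCount ns (interior a)) (upTo n) +_) (sumBy-comm extremes (upTo n) (box ns)) ⟩
    sumBy (λ a → onesCount ns (interior a)) (upTo n) + sumBy (λ r → sumBy (λ a → extremes a r) (upTo n)) (box ns)
      ≤⟨ +-monoʳ-≤ _ (sumBy-≤-* _ 2 (box ns) (λ {r} _ → extremes-in-row≤2 r)) ⟩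
    sumBy (λ a → onesCount ns (interior a)) (upTo n) + length (box ns) * 2  ∎
    where
    open ≤-Reasoning
    slice≤ : ∀ a → onesCount ns (λ r → M (a ∷ r)) ≤ onesCount ns (interior a) + sumBy (extremes a) (box ns)
    slice≤ a = begin
      onesCount ns (λ r → M (a ∷ r))                                         ≡⟨ length-filterᵇ _ (box ns) ⟩
      sumBy (λ r → indicator (M (a ∷ r))) (box ns)                           ≤⟨ sumBy-mono (one≤interior+extremes a) (box ns) ⟩
      sumBy (λ r → indicator (interior a r) + extremes a r) (box ns)         ≡⟨ sumBy-+ _ _ (box ns) ⟩
      sumBy (indicator ∘ interior a) (box ns) + sumBy (extremes a) (box ns)  ≡⟨ cong (_+ sumBy (extremes a) (box ns)) (sym (length-filterᵇ (interior a) (box ns))) ⟩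
      onesCount ns (interior a) + sumBy (extremes a) (box ns)                ∎

  interior-avoids : ∀ {ps : Vec ℕ d} {P : Matrix d} → ¬ Formation n M ps P 3 →
                    ∀ {a} → a < n → Avoids (replicate d n) (interior a) ps P
  interior-avoids {ps} no-formation {a} a<n copy =
    no-formation (stacked-copy⇒formation {n = n} {M = M} {ps = ps} {Q = interior a} heights layer-one layers-ordered copy)
    where
    below above : Point d → ℕ
    below r = choose (λ c → (c <ᵇ a) ∧ M (c ∷ r)) 0 (upTo n)
    above r = choose (λ c → (a <ᵇ c) ∧ M (c ∷ r)) 0 (upTo n)

    heights : Fin 3 → Point d → ℕ
    heights i r = lookup (below r ∷ a ∷ above r ∷ Vec.[]) i

    below-one : ∀ {r} → T (interior a r) → below r < a × T (M (below r ∷ r))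
    below-one {r} t with choose-witness (λ c → (c <ᵇ a) ∧ M (c ∷ r)) 0 (upTo n) (proj₁ (proj₂ (interior-parts t)))
    ... | _ , c<a∧one = Product.map₁ (<ᵇ⇒< (below r) a) (Equivalence.to (T-∧ {below r <ᵇ a}) c<a∧one)

    above-one : ∀ {r} → T (interior a r) → (a < above r × above r < n) × T (M (above r ∷ r))
    above-one {r} t with choose-witness (λ c → (a <ᵇ c) ∧ M (c ∷ r)) 0 (upTo n) (proj₂ (proj₂ (interior-parts t)))
    ... | c∈ , a<c∧one = Product.map₁ (λ a<c → <ᵇ⇒< a (above r) a<c , ∈-upTo⁻ c∈) (Equivalence.to (T-∧ {a <ᵇ above r}) a<c∧one)

    layer-one : ∀ {r} → T (interior a r) → ∀ i → heights i r < n × T (M (heights i r ∷ r))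
    layer-one t zero             = Product.map₁ (λ b<a → <-trans b<a a<n) (below-one t)
    layer-one t (suc zero)       = a<n , proj₁ (interior-parts t)
    layer-one t (suc (suc zero)) = Product.map₁ proj₂ (above-one t)

    layers-ordered : ∀ {r r′} → T (interior a r) → T (interior a r′) → ∀ {i j} → i Fin.< j → heights i r < heights j r′
    layers-ordered t t′ {zero}           {suc zero}       _ = proj₁ (below-one t)
    layers-ordered t t′ {zero}           {suc (suc zero)} _ = <-trans (proj₁ (below-one t)) (proj₁ (proj₁ (above-one t′)))
    layers-ordered t t′ {suc zero}       {suc (suc zero)} _ = proj₁ (proj₁ (above-one t′))
    layers-ordered t t′ {_}              {zero}           ()
    layers-ordered t t′ {suc zero}       {suc zero}       (s≤s ())
    layers-ordered t t′ {suc (suc zero)} {suc zero}       (s≤s ())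
    layers-ordered t t′ {suc (suc zero)} {suc (suc zero)} (s≤s (s≤s ()))

n*e+N*2≤3*[e*n+N] : ∀ n e N → n * e + N * 2 ≤ 3 * (e * n + N)
n*e+N*2≤3*[e*n+N] n e N = subst (n * e + N * 2 ≤_) (identity n e N) (m≤m+n _ (e * n * 2 + N))
  where
  identity : ∀ n e N → n * e + N * 2 + (e * n * 2 + N) ≡ 3 * (e * n + N)
  identity = solve-∀

corollary2 : (d : ℕ) → 1 ≤ d → (ps : Vec ℕ d) → (P : Matrix d) →
    (n : ℕ) → 1 ≤ n → (e f : ℕ) →
    IsEx d n ps P e → IsExFormation d n ps P 3 f →
    f ≤ 3 * (e * n + n ^ d)
corollary2 d _ ps P n _ e f (_ , avoiders≤e) ((M , no-formation , refl) , _) = begin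
  onesCount (replicate (ℕ.suc d) n) M
    ≤⟨ onesCount≤interior+extremes (replicate d n) ⟩
  sumBy (λ a → onesCount (replicate d n) (interior a)) (upTo n) + length (box (replicate d n)) * 2
    ≤⟨ +-mono-≤ (sumBy-≤-* _ e (upTo n) interior≤e) (≤-reflexive (cong (_* 2) (length-box d n))) ⟩
  length (upTo n) * e + n ^ d * 2
    ≡⟨ cong (λ k → k * e + n ^ d * 2) (length-upTo n) ⟩
  n * e + n ^ d * 2
    ≤⟨ n*e+N*2≤3*[e*n+N] n e (n ^ d) ⟩
  3 * (e * n + n ^ d) ∎
  where
  open ≤-Reasoning
  open Slices n M
  interior≤e : ∀ {a} → a ∈ upTo n → onesCount (replicate d n) (interior a) ≤ e
  interior≤e a∈ = avoiders≤e _ (interior-avoids {ps = ps} no-formation (∈-upTo⁻ a∈))
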